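{- For positive integers $m\leq n$, $$ \sum_{\substack{\lambda\vdash n\\ \lambda_1=m}} q^{\sum_i\lambda_i^2}\prod_{i\geq1}{\lambda_i \brack \lambda_{i+1}}_q = q^{m^2+n-m}{n-1 \brack m-1}_q, $$ where the sum is over all partitions $\lambda=(\lambda_1,\lambda_2,\ldots)$ of $n$ with largest part $m$, and $\lambda_i=0$ for $i$ larger than the number of parts.
   Context: ${a\brack b}_q=\prod_{i=1}^b\frac{q^{a-i+1}-1}{q^i-1}$ is the $q$-binomial coefficient (equal to $1$ when $b=0$); $q$ may be treated as an indeterminate. -}

module Defs where

open import Data.Nat as ℕ using (ℕ; zero; suc; _∸_; _≥_; _≤_)
open import Data.List using (List; []; _∷_; map; foldr)
open import Data.Nat.ListAction using (sum)
open import Data.List.Relation.Unary.All using (All)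
open import Data.List.Relation.Unary.Linked using (Linked)
open import Data.Product using (∃; _×_)
open import Data.Rational as ℚ using (ℚ; 0ℚ; 1ℚ; _*_; _-_; _+_; _÷_; ≢-nonZero)
open import Data.Rational.Properties using (_≟_)
open import Relation.Nullary using (yes; no)
open import Relation.Binary.PropositionalEquality using (_≡_)

pow : ℚ → ℕ → ℚ
pow q zero    = 1ℚ
pow q (suc k) = q * pow q k

-- total division on ℚ (x / 0 := 0); only ever used with nonzero divisors below
_÷₀_ : ℚ → ℚ → ℚ
x ÷₀ y with y ≟ 0ℚ
... | yes _  = 0ℚ
... | no y≢0 = _÷_ x y {{≢-nonZero y≢0}}

-- q-binomial coefficient  [a b]_q = ∏_{i=1}^{b} (q^{a-i+1} - 1)/(q^i - 1),
-- evaluated at q.  The factor for i = b+1 is (q^{a-b} - 1)/(q^{b+1} - 1).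
qbin : ℚ → ℕ → ℕ → ℚ
qbin q a zero    = 1ℚ
qbin q a (suc b) = qbin q a b * ((pow q (a ∸ b) - 1ℚ) ÷₀ (pow q (suc b) - 1ℚ))

IsPartitionWithLargest : ℕ → ℕ → List ℕ → Set
IsPartitionWithLargest n m λs =
  Linked _≥_ λs × All (1 ≤_) λs × sum λs ≡ n × ∃ λ rest → λs ≡ m ∷ rest

sumSq : List ℕ → ℕ
sumSq λs = sum (map (λ x → x ℕ.* x) λs)

prodQbin : ℚ → List ℕ → ℚ
prodQbin q []           = 1ℚ
prodQbin q (x ∷ [])     = qbin q x 0
prodQbin q (x ∷ y ∷ r)  = qbin q x y * prodQbin q (y ∷ r)

weight : ℚ → List ℕ → ℚ
weight q λs = pow q (sumSq λs) * prodQbin q λs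

sumℚ : List ℚ → ℚ
sumℚ = foldr _+_ 0ℚ

-- Splitting off the largest part m, the sum is q^(m²) Z(n − m, m), where Z(r, m) sums
-- q^(Σ μᵢ²) [m, μ₁] ∏ [μᵢ, μᵢ₊₁] over the partitions μ of r into parts at most m.
-- Splitting off the first part k of μ gives Z(r, m) = Σₖ [m, k] q^(k²) Z(r − k, k), and by
-- induction on r this is q^r [m + r − 1, r]: after the induction hypothesis the sum becomes the
-- q-Vandermonde sum Σⱼ [m, j] [r − 1, r − j] q^(j(j − 1)) = [m + r − 1, r]. The symmetry
-- [n − 1, n − m] = [n − 1, m − 1] finishes the proof.
-- The Gaussian binomials are computed by the q-Pascal rule; it agrees with the product formula
-- because both satisfy [a, b + 1] (q^(b+1) − 1) = [a, b] (q^(a−b) − 1), and q^(b+1) ≠ 1 when q ≠ ±1.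

module Submission where

open import Defs
open import Data.Nat using (ℕ; _≤_; _∸_; _+_; _*_)
open import Data.List using (List; map)
open import Data.List.Relation.Unary.Unique.Propositional using (Unique)
open import Data.List.Membership.Propositional using (_∈_)
open import Data.Rational as ℚ using (ℚ; 1ℚ; -_)
open import Function.Bundles using (_⇔_)
open import Relation.Binary.PropositionalEquality using (_≡_; _≢_)

open import Algebra.Bundles using (CommutativeMonoid)
open import Data.Empty using (⊥-elim)
open import Data.List using ([]; _∷_; _++_; length)
import Data.List.Properties as ListP
open import Data.List.Membership.Propositional.Properties using (∈-map⁺; ∈-map⁻; ∈-++⁺ˡ; ∈-++⁺ʳ; ∈-++⁻)
open import Data.List.Membership.Propositional.Properties.WithK using (unique∧set⇒bag)
open import Data.List.Relation.Binary.BagAndSetEquality using (_∼[_]_; set; ∼bag⇒↭)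
open import Data.List.Relation.Binary.Permutation.Propositional using (_↭_; ↭⇒↭ₛ)
import Data.List.Relation.Binary.Permutation.Propositional.Properties as ↭
open import Data.List.Relation.Binary.Permutation.Setoid.Properties using (foldr-commMonoid)
open import Data.List.Relation.Unary.All using (All; []; _∷_)
open import Data.List.Relation.Unary.Any using (here)
open import Data.List.Relation.Unary.Linked using (Linked; []; [-]; _∷_)
open import Data.List.Relation.Unary.Unique.Propositional using ([]; _∷_)
import Data.List.Relation.Unary.Unique.Propositional.Properties as Unique
open import Data.Nat using (zero; suc; _<_; _≥_; _⊓_; s≤s; z≤n)
open import Data.Nat.ListAction using (sum)
import Data.Nat.Properties as ℕP
import Data.Nat.Solver as ℕSolver
open import Data.Product using (∃₂; _,_; _×_)
open import Data.Rational using (0ℚ; ∣_∣)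
import Data.Rational.Properties as ℚP
open import Data.Rational.Solver using (module +-*-Solver)
open import Data.Sum using (inj₁; inj₂)
open import Function.Bundles using (mk⇔)
open import Function.Properties.Equivalence using (⇔-isEquivalence)
open import Relation.Binary.Definitions using (tri<; tri≈; tri>)
open import Relation.Binary.PropositionalEquality using (refl; sym; trans; cong; cong₂; subst; module ≡-Reasoning)
open import Relation.Binary.Structures using (IsEquivalence)
open import Relation.Nullary using (¬_; yes; no)

vandermonde-exponent : ∀ {b c j} → j ≤ c → suc (c ∸ j) ≤ b →
  suc (c ∸ j) + j * (b + j ∸ c) ≡ suc c + j * (b + j ∸ suc c)
vandermonde-exponent {b} {c} {j} j≤c c-j<b with ℕP.m≤n⇒∃[o]m+o≡n j≤c
... | d , refl rewrite ℕP.m+n∸m≡n j d with ℕP.m≤n⇒∃[o]m+o≡n c-j<b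
... | e , refl = begin
    suc d + j * (suc d + e + j ∸ (j + d))      ≡⟨ cong (λ t → suc d + j * (t ∸ (j + d))) (ℕS.solve 3
                                                    (λ d e j → con 1 :+ d :+ e :+ j := (j :+ d) :+ (con 1 :+ e)) refl d e j) ⟩
    suc d + j * (j + d + suc e ∸ (j + d))      ≡⟨ cong (λ t → suc d + j * t) (ℕP.m+n∸m≡n (j + d) (suc e)) ⟩
    suc d + j * suc e                          ≡⟨ ℕS.solve 3 (λ d e j → con 1 :+ d :+ j :* (con 1 :+ e)
                                                    := con 1 :+ (j :+ d) :+ j :* e) refl d e j ⟩
    suc (j + d) + j * e                        ≡⟨ cong (λ t → suc (j + d) + j * t) (sym (ℕP.m+n∸m≡n (suc (j + d)) e)) ⟩
    suc (j + d) + j * (suc (j + d) + e ∸ suc (j + d))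
                                               ≡⟨ cong (λ t → suc (j + d) + j * (t ∸ suc (j + d))) (ℕS.solve 3
                                                    (λ d e j → con 1 :+ (j :+ d) :+ e := con 1 :+ d :+ e :+ j) refl d e j) ⟩
    suc (j + d) + j * (suc d + e + j ∸ suc (j + d))
  ∎
  where
    open ≡-Reasoning
    module ℕS = ℕSolver.+-*-Solver
    open ℕS

closedForm-exponent : ∀ {k r} → k ≤ r → suc k * suc k + (r ∸ k) ≡ suc r + suc k * (r + suc k ∸ suc r)
closedForm-exponent {k} {r} k≤r with ℕP.m≤n⇒∃[o]m+o≡n k≤r
... | d , refl rewrite ℕP.m+n∸m≡n k d | ℕP.+-suc (k + d) k | ℕP.m+n∸m≡n (k + d) k =
  solve 2 (λ k d → (con 1 :+ k) :* (con 1 :+ k) :+ d := con 1 :+ (k :+ d) :+ (con 1 :+ k) :* k) refl k d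
  where open ℕSolver.+-*-Solver

open +-*-Solver

pow-distribˡ-+-* : ∀ q m n → pow q (m + n) ≡ pow q m ℚ.* pow q n
pow-distribˡ-+-* q zero    n = sym (ℚP.*-identityˡ _)
pow-distribˡ-+-* q (suc m) n = trans (cong (q ℚ.*_) (pow-distribˡ-+-* q m n)) (sym (ℚP.*-assoc q _ _))

∣qⁿ∣≡∣q∣ⁿ : ∀ q n → ∣ pow q n ∣ ≡ pow ∣ q ∣ n
∣qⁿ∣≡∣q∣ⁿ q zero    = refl
∣qⁿ∣≡∣q∣ⁿ q (suc n) = trans (ℚP.∣p*q∣≡∣p∣*∣q∣ q (pow q n)) (cong (∣ q ∣ ℚ.*_) (∣qⁿ∣≡∣q∣ⁿ q n))

module _ (a : ℚ) .{{_ : ℚ.NonNegative a}} where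

  pow≤1 : a ℚ.≤ 1ℚ → ∀ n → pow a n ℚ.≤ 1ℚ
  pow≤1 a≤1 zero    = ℚP.≤-refl
  pow≤1 a≤1 (suc n) = ℚP.≤-trans (ℚP.*-monoˡ-≤-nonNeg a (pow≤1 a≤1 n))
                                  (ℚP.≤-trans (ℚP.≤-reflexive (ℚP.*-identityʳ a)) a≤1)

  1≤pow : 1ℚ ℚ.≤ a → ∀ n → 1ℚ ℚ.≤ pow a n
  1≤pow 1≤a zero    = ℚP.≤-refl
  1≤pow 1≤a (suc n) = ℚP.≤-trans 1≤a (ℚP.≤-trans (ℚP.≤-reflexive (sym (ℚP.*-identityʳ a)))
                                                  (ℚP.*-monoˡ-≤-nonNeg a (1≤pow 1≤a n)))

  pow-suc≢1-nonNeg : a ≢ 1ℚ → ∀ n → pow a (suc n) ≢ 1ℚ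
  pow-suc≢1-nonNeg a≢1 n aⁿ⁺¹≡1 with ℚP.<-cmp a 1ℚ
  ... | tri≈ _ a≡1 _ = a≢1 a≡1
  ... | tri< a<1 _ _ = ℚP.<-irrefl aⁿ⁺¹≡1 (ℚP.≤-<-trans
          (ℚP.≤-trans (ℚP.*-monoˡ-≤-nonNeg a (pow≤1 (ℚP.<⇒≤ a<1) n)) (ℚP.≤-reflexive (ℚP.*-identityʳ a)))
          a<1)
  ... | tri> _ _ 1<a = ℚP.<-irrefl (sym aⁿ⁺¹≡1) (ℚP.<-≤-trans 1<a
          (ℚP.≤-trans (ℚP.≤-reflexive (sym (ℚP.*-identityʳ a))) (ℚP.*-monoˡ-≤-nonNeg a (1≤pow (ℚP.<⇒≤ 1<a) n))))

pow-suc≢1 : ∀ {q} → q ≢ 1ℚ → q ≢ - 1ℚ → ∀ n → pow q (suc n) ≢ 1ℚ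
pow-suc≢1 {q} q≢1 q≢-1 n qⁿ⁺¹≡1 =
  pow-suc≢1-nonNeg ∣ q ∣ {{ℚP.∣-∣-nonNeg q}} ∣q∣≢1 n (trans (sym (∣qⁿ∣≡∣q∣ⁿ q (suc n))) (cong ∣_∣ qⁿ⁺¹≡1))
  where
    ∣q∣≢1 : ∣ q ∣ ≢ 1ℚ
    ∣q∣≢1 ∣q∣≡1 with ℚP.∣p∣≡p∨∣p∣≡-p q
    ... | inj₁ ∣q∣≡q  = q≢1 (trans (sym ∣q∣≡q) ∣q∣≡1)
    ... | inj₂ ∣q∣≡-q = q≢-1 (trans (solve 1 (λ x → x := :- (:- x)) refl q) (cong -_ (trans (sym ∣q∣≡-q) ∣q∣≡1)))

x*d≡y*n⇒x≡y*[n÷₀d] : ∀ {x y n d} → d ≢ 0ℚ → x ℚ.* d ≡ y ℚ.* n → x ≡ y ℚ.* (n ÷₀ d)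
x*d≡y*n⇒x≡y*[n÷₀d] {x} {y} {n} {d} d≢0 eq with d ℚP.≟ 0ℚ
... | yes d≡0 = ⊥-elim (d≢0 d≡0)
... | no  d≢0′ = begin
    x                    ≡⟨ sym (ℚP.*-identityʳ x) ⟩
    x ℚ.* 1ℚ             ≡⟨ cong (x ℚ.*_) (sym (ℚP.*-inverseʳ d)) ⟩
    x ℚ.* (d ℚ.* d⁻¹)    ≡⟨ sym (ℚP.*-assoc x d d⁻¹) ⟩
    x ℚ.* d ℚ.* d⁻¹      ≡⟨ cong (ℚ._* d⁻¹) eq ⟩
    y ℚ.* n ℚ.* d⁻¹      ≡⟨ ℚP.*-assoc y n d⁻¹ ⟩
    y ℚ.* (n ℚ.* d⁻¹)    ∎
  where
    open ≡-Reasoning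
    instance _ = ℚ.≢-nonZero d≢0′
    d⁻¹ = ℚ.1/ d

-- Gaussian binomial coefficients

module _ (q : ℚ) where

  gauss : ℕ → ℕ → ℚ
  gauss n       zero    = 1ℚ
  gauss zero    (suc k) = 0ℚ
  gauss (suc n) (suc k) = gauss n k ℚ.+ pow q (suc k) ℚ.* gauss n (suc k)

  n<k⇒gauss≡0 : ∀ {n k} → n < k → gauss n k ≡ 0ℚ
  n<k⇒gauss≡0 {zero}  {suc k} _ = refl
  n<k⇒gauss≡0 {suc n} {suc k} (s≤s n<k)
    rewrite n<k⇒gauss≡0 n<k | n<k⇒gauss≡0 (ℕP.m<n⇒m<1+n n<k) =
      solve 1 (λ x → con 0ℚ :+ x :* con 0ℚ := con 0ℚ) refl (pow q (suc k))

  gauss[n,n]≡1 : ∀ n → gauss n n ≡ 1ℚ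
  gauss[n,n]≡1 zero = refl
  gauss[n,n]≡1 (suc n) rewrite gauss[n,n]≡1 n | n<k⇒gauss≡0 (ℕP.n<1+n n) =
    solve 1 (λ x → con 1ℚ :+ x :* con 0ℚ := con 1ℚ) refl (pow q (suc n))

  gauss-ratio : ∀ a b → gauss a (suc b) ℚ.* (pow q (suc b) ℚ.- 1ℚ) ≡ gauss a b ℚ.* (pow q (a ∸ b) ℚ.- 1ℚ)
  gauss-ratio zero b rewrite ℕP.0∸n≡0 b =
    solve 2 (λ x y → con 0ℚ :* (x :- con 1ℚ) := y :* (con 1ℚ :- con 1ℚ)) refl (pow q (suc b)) (gauss zero b)
  gauss-ratio (suc a) zero = begin
      (1ℚ ℚ.+ q ℚ.* 1ℚ ℚ.* X) ℚ.* (q ℚ.* 1ℚ ℚ.- 1ℚ)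
    ≡⟨ solve 2 (λ x q → (con 1ℚ :+ q :* con 1ℚ :* x) :* (q :* con 1ℚ :- con 1ℚ)
                  := (q :- con 1ℚ) :+ q :* (x :* (q :* con 1ℚ :- con 1ℚ))) refl X q ⟩
      (q ℚ.- 1ℚ) ℚ.+ q ℚ.* (X ℚ.* (q ℚ.* 1ℚ ℚ.- 1ℚ))
    ≡⟨ cong (λ t → (q ℚ.- 1ℚ) ℚ.+ q ℚ.* t) (gauss-ratio a zero) ⟩
      (q ℚ.- 1ℚ) ℚ.+ q ℚ.* (1ℚ ℚ.* (pow q a ℚ.- 1ℚ))
    ≡⟨ solve 2 (λ q y → (q :- con 1ℚ) :+ q :* (con 1ℚ :* (y :- con 1ℚ)) := con 1ℚ :* (q :* y :- con 1ℚ)) refl q (pow q a) ⟩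
      1ℚ ℚ.* (q ℚ.* pow q a ℚ.- 1ℚ)
    ∎
    where
      open ≡-Reasoning
      X = gauss a 1
  gauss-ratio (suc a) (suc b) with ℕP.<-≤-connex b a
  ... | inj₂ a≤b
    rewrite n<k⇒gauss≡0 (s≤s a≤b) | n<k⇒gauss≡0 (s≤s (ℕP.m≤n⇒m≤1+n a≤b)) | ℕP.m≤n⇒m∸n≡0 a≤b =
      solve 3 (λ x y z → (con 0ℚ :+ x :* con 0ℚ) :* (x :- con 1ℚ) := (z :+ y :* con 0ℚ) :* (con 1ℚ :- con 1ℚ))
        refl (pow q (suc (suc b))) (pow q (suc b)) (gauss a b)
  ... | inj₁ b<a = begin
      (X ℚ.+ q ℚ.* Q ℚ.* Y) ℚ.* (q ℚ.* Q ℚ.- 1ℚ)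
    ≡⟨ solve 4 (λ x y q Q → (x :+ q :* Q :* y) :* (q :* Q :- con 1ℚ)
                  := x :* (q :* Q :- con 1ℚ) :+ q :* Q :* (y :* (q :* Q :- con 1ℚ))) refl X Y q Q ⟩
      X ℚ.* (q ℚ.* Q ℚ.- 1ℚ) ℚ.+ q ℚ.* Q ℚ.* (Y ℚ.* (q ℚ.* Q ℚ.- 1ℚ))
    ≡⟨ cong (λ t → X ℚ.* (q ℚ.* Q ℚ.- 1ℚ) ℚ.+ q ℚ.* Q ℚ.* t) (gauss-ratio a (suc b)) ⟩
      X ℚ.* (q ℚ.* Q ℚ.- 1ℚ) ℚ.+ q ℚ.* Q ℚ.* (X ℚ.* (E ℚ.- 1ℚ))
    ≡⟨ solve 4 (λ x q Q E → x :* (q :* Q :- con 1ℚ) :+ q :* Q :* (x :* (E :- con 1ℚ))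
                  := x :* (Q :- con 1ℚ) :+ Q :* x :* (q :* E :- con 1ℚ)) refl X q Q E ⟩
      X ℚ.* (Q ℚ.- 1ℚ) ℚ.+ Q ℚ.* X ℚ.* (q ℚ.* E ℚ.- 1ℚ)
    ≡⟨ cong (λ t → t ℚ.+ Q ℚ.* X ℚ.* (q ℚ.* E ℚ.- 1ℚ)) (gauss-ratio a b) ⟩
      Z ℚ.* (pow q (a ∸ b) ℚ.- 1ℚ) ℚ.+ Q ℚ.* X ℚ.* (q ℚ.* E ℚ.- 1ℚ)
    ≡⟨ cong (λ t → Z ℚ.* (pow q t ℚ.- 1ℚ) ℚ.+ Q ℚ.* X ℚ.* (q ℚ.* E ℚ.- 1ℚ)) a∸b≡1+a∸[1+b] ⟩
      Z ℚ.* (q ℚ.* E ℚ.- 1ℚ) ℚ.+ Q ℚ.* X ℚ.* (q ℚ.* E ℚ.- 1ℚ)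
    ≡⟨ sym (ℚP.*-distribʳ-+ (q ℚ.* E ℚ.- 1ℚ) Z (Q ℚ.* X)) ⟩
      (Z ℚ.+ Q ℚ.* X) ℚ.* (q ℚ.* E ℚ.- 1ℚ)
    ≡⟨ cong (λ t → (Z ℚ.+ Q ℚ.* X) ℚ.* (pow q t ℚ.- 1ℚ)) (sym a∸b≡1+a∸[1+b]) ⟩
      (Z ℚ.+ Q ℚ.* X) ℚ.* (pow q (a ∸ b) ℚ.- 1ℚ)
    ∎
    where
      open ≡-Reasoning
      X = gauss a (suc b)
      Y = gauss a (suc (suc b))
      Z = gauss a b
      Q = pow q (suc b)
      E = pow q (a ∸ suc b)
      a∸b≡1+a∸[1+b] : a ∸ b ≡ suc (a ∸ suc b)
      a∸b≡1+a∸[1+b] = ℕP.+-∸-assoc 1 b<a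

  qbin≡gauss : q ≢ 1ℚ → q ≢ - 1ℚ → ∀ a b → qbin q a b ≡ gauss a b
  qbin≡gauss q≢1 q≢-1 a zero    = refl
  qbin≡gauss q≢1 q≢-1 a (suc b) = sym (x*d≡y*n⇒x≡y*[n÷₀d] {y = qbin q a b} {n = pow q (a ∸ b) ℚ.- 1ℚ} qᵇ⁺¹-1≢0
    (trans (gauss-ratio a b) (cong (ℚ._* (pow q (a ∸ b) ℚ.- 1ℚ)) (sym (qbin≡gauss q≢1 q≢-1 a b)))))
    where
      qᵇ⁺¹-1≢0 : pow q (suc b) ℚ.- 1ℚ ≢ 0ℚ
      qᵇ⁺¹-1≢0 eq = pow-suc≢1 q≢1 q≢-1 b
        (trans (solve 1 (λ x → x := (x :- con 1ℚ) :+ con 1ℚ) refl (pow q (suc b))) (cong (ℚ._+ 1ℚ) eq))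

-- Finite sums and the q-Vandermonde identity

sumUpTo : ℕ → (ℕ → ℚ) → ℚ
sumUpTo zero    g = g 0
sumUpTo (suc n) g = sumUpTo n g ℚ.+ g (suc n)

syntax sumUpTo n (λ j → g) = ∑[ j ≤ n ] g

∑-cong : ∀ {g h : ℕ → ℚ} n → (∀ j → j ≤ n → g j ≡ h j) → ∑[ j ≤ n ] g j ≡ ∑[ j ≤ n ] h j
∑-cong zero    g≗h = g≗h 0 z≤n
∑-cong (suc n) g≗h = cong₂ ℚ._+_ (∑-cong n (λ j j≤n → g≗h j (ℕP.m≤n⇒m≤1+n j≤n))) (g≗h (suc n) ℕP.≤-refl)

∑-zero : ∀ {g : ℕ → ℚ} n → (∀ j → j ≤ n → g j ≡ 0ℚ) → ∑[ j ≤ n ] g j ≡ 0ℚ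
∑-zero zero    g≡0 = g≡0 0 z≤n
∑-zero (suc n) g≡0 = cong₂ ℚ._+_ (∑-zero n (λ j j≤n → g≡0 j (ℕP.m≤n⇒m≤1+n j≤n))) (g≡0 (suc n) ℕP.≤-refl)

∑-distrib-+ : ∀ (g h : ℕ → ℚ) n → ∑[ j ≤ n ] (g j ℚ.+ h j) ≡ ∑[ j ≤ n ] g j ℚ.+ ∑[ j ≤ n ] h j
∑-distrib-+ g h zero    = refl
∑-distrib-+ g h (suc n) rewrite ∑-distrib-+ g h n =
  solve 4 (λ a b c d → (a :+ b) :+ (c :+ d) := (a :+ c) :+ (b :+ d)) refl
    (sumUpTo n g) (sumUpTo n h) (g (suc n)) (h (suc n))

∑-distribˡ-* : ∀ c (g : ℕ → ℚ) n → ∑[ j ≤ n ] (c ℚ.* g j) ≡ c ℚ.* ∑[ j ≤ n ] g j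
∑-distribˡ-* c g zero    = refl
∑-distribˡ-* c g (suc n) rewrite ∑-distribˡ-* c g n = sym (ℚP.*-distribˡ-+ c (sumUpTo n g) (g (suc n)))

∑-extend : ∀ {g : ℕ → ℚ} m d → (∀ j → m < j → g j ≡ 0ℚ) → ∑[ j ≤ m + d ] g j ≡ ∑[ j ≤ m ] g j
∑-extend m zero    g≡0 rewrite ℕP.+-identityʳ m = refl
∑-extend {g} m (suc d) g≡0 rewrite ℕP.+-suc m d =
  trans (cong₂ ℚ._+_ (∑-extend m d g≡0) (g≡0 (suc (m + d)) (s≤s (ℕP.m≤m+n m d)))) (ℚP.+-identityʳ _)

∑-⊓ : ∀ {g : ℕ → ℚ} m n → (∀ j → m < j → g j ≡ 0ℚ) → ∑[ j ≤ m ⊓ n ] g j ≡ ∑[ j ≤ n ] g j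
∑-⊓ {g} m n g≡0 with ℕP.≤-total m n
... | inj₁ m≤n rewrite ℕP.m≤n⇒m⊓n≡m m≤n =
  trans (sym (∑-extend m (n ∸ m) g≡0)) (cong (λ k → ∑[ j ≤ k ] g j) (ℕP.m+[n∸m]≡n m≤n))
... | inj₂ n≤m rewrite ℕP.m≥n⇒m⊓n≡n n≤m = refl

module _ (q : ℚ) where

  -- The exponent only matters where the Gaussian factor is nonzero; this absorbs the
  -- truncated subtractions in the exponents of the q-Vandermonde terms.
  gauss*pow-cong : ∀ {b i x y} → (i ≤ b → x ≡ y) → gauss q b i ℚ.* pow q x ≡ gauss q b i ℚ.* pow q y
  gauss*pow-cong {b} {i} {x} {y} x≡y with i ℕP.≤? b
  ... | yes i≤b = cong (λ t → gauss q b i ℚ.* pow q t) (x≡y i≤b)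
  ... | no  i≰b rewrite n<k⇒gauss≡0 q (ℕP.≰⇒> i≰b) = trans (ℚP.*-zeroˡ (pow q x)) (sym (ℚP.*-zeroˡ (pow q y)))

  vandermondeTerm : ℕ → ℕ → ℕ → ℕ → ℚ
  vandermondeTerm a b c j = gauss q a j ℚ.* gauss q b (c ∸ j) ℚ.* pow q (j * (b + j ∸ c))

  vandermondeTerm-pascal : ∀ a b c j → j ≤ c →
    vandermondeTerm a (suc b) (suc c) j ≡ vandermondeTerm a b c j ℚ.+ pow q (suc c) ℚ.* vandermondeTerm a b (suc c) j
  vandermondeTerm-pascal a b c j j≤c = begin
      A ℚ.* gauss q (suc b) (suc c ∸ j) ℚ.* E
    ≡⟨ cong (λ t → A ℚ.* gauss q (suc b) t ℚ.* E) 1+c∸j≡1+[c∸j] ⟩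
      A ℚ.* (gauss q b (c ∸ j) ℚ.+ pow q (suc (c ∸ j)) ℚ.* G) ℚ.* E
    ≡⟨ solve 5 (λ A Z W G E → A :* (Z :+ W :* G) :* E := A :* Z :* E :+ A :* (G :* (W :* E)))
         refl A (gauss q b (c ∸ j)) (pow q (suc (c ∸ j))) G E ⟩
      vandermondeTerm a b c j ℚ.+ A ℚ.* (G ℚ.* (pow q (suc (c ∸ j)) ℚ.* E))
    ≡⟨ cong (λ t → vandermondeTerm a b c j ℚ.+ A ℚ.* (G ℚ.* t)) (sym (pow-distribˡ-+-* q (suc (c ∸ j)) _)) ⟩
      vandermondeTerm a b c j ℚ.+ A ℚ.* (G ℚ.* pow q (suc (c ∸ j) + j * (b + j ∸ c)))
    ≡⟨ cong (λ t → vandermondeTerm a b c j ℚ.+ A ℚ.* t) (gauss*pow-cong {b = b} (vandermonde-exponent j≤c)) ⟩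
      vandermondeTerm a b c j ℚ.+ A ℚ.* (G ℚ.* pow q (suc c + j * (b + j ∸ suc c)))
    ≡⟨ cong (λ t → vandermondeTerm a b c j ℚ.+ A ℚ.* (G ℚ.* t)) (pow-distribˡ-+-* q (suc c) _) ⟩
      vandermondeTerm a b c j ℚ.+ A ℚ.* (G ℚ.* (pow q (suc c) ℚ.* E′))
    ≡⟨ cong (vandermondeTerm a b c j ℚ.+_) (solve 4 (λ A G C E → A :* (G :* (C :* E)) := C :* (A :* G :* E))
         refl A G (pow q (suc c)) E′) ⟩
      vandermondeTerm a b c j ℚ.+ pow q (suc c) ℚ.* (A ℚ.* G ℚ.* E′)
    ≡⟨ cong (λ t → vandermondeTerm a b c j ℚ.+ pow q (suc c) ℚ.* (A ℚ.* gauss q b t ℚ.* E′)) (sym 1+c∸j≡1+[c∸j]) ⟩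
      vandermondeTerm a b c j ℚ.+ pow q (suc c) ℚ.* vandermondeTerm a b (suc c) j
    ∎
    where
      open ≡-Reasoning
      1+c∸j≡1+[c∸j] : suc c ∸ j ≡ suc (c ∸ j)
      1+c∸j≡1+[c∸j] = ℕP.+-∸-assoc 1 j≤c
      A = gauss q a j
      G = gauss q b (suc (c ∸ j))
      E = pow q (j * (b + j ∸ c))
      E′ = pow q (j * (b + j ∸ suc c))

  vandermondeTerm-last : ∀ a b c → vandermondeTerm a (suc b) c c ≡ pow q c ℚ.* vandermondeTerm a b c c
  vandermondeTerm-last a b c rewrite ℕP.n∸n≡0 c | ℕP.m+n∸n≡m (suc b) c | ℕP.m+n∸n≡m b c
                                   | ℕP.*-suc c b | pow-distribˡ-+-* q c (c * b) =
    solve 3 (λ A x y → A :* con 1ℚ :* (x :* y) := x :* (A :* con 1ℚ :* y)) refl (gauss q a c) (pow q c) (pow q (c * b))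

  q-vandermonde : ∀ a b c → ∑[ j ≤ c ] vandermondeTerm a b c j ≡ gauss q (a + b) c
  q-vandermonde a zero zero = refl
  q-vandermonde a zero (suc c) = begin
      ∑[ j ≤ c ] vandermondeTerm a 0 (suc c) j ℚ.+ vandermondeTerm a 0 (suc c) (suc c)
    ≡⟨ cong₂ ℚ._+_ (∑-zero c vanish) last ⟩
      0ℚ ℚ.+ gauss q a (suc c)
    ≡⟨ ℚP.+-identityˡ _ ⟩
      gauss q a (suc c)
    ≡⟨ cong (λ n → gauss q n (suc c)) (sym (ℕP.+-identityʳ a)) ⟩
      gauss q (a + 0) (suc c)
    ∎
    where
      open ≡-Reasoning
      vanish : ∀ j → j ≤ c → vandermondeTerm a 0 (suc c) j ≡ 0ℚ
      vanish j j≤c rewrite ℕP.+-∸-assoc 1 j≤c =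
        trans (cong (ℚ._* pow q (j * (j ∸ suc c))) (ℚP.*-zeroʳ (gauss q a j))) (ℚP.*-zeroˡ (pow q (j * (j ∸ suc c))))
      last : vandermondeTerm a 0 (suc c) (suc c) ≡ gauss q a (suc c)
      last rewrite ℕP.n∸n≡0 c | ℕP.*-zeroʳ c = trans (ℚP.*-identityʳ _) (ℚP.*-identityʳ _)
  q-vandermonde a (suc b) zero = refl
  q-vandermonde a (suc b) (suc c) = begin
      ∑[ j ≤ c ] vandermondeTerm a (suc b) (suc c) j ℚ.+ vandermondeTerm a (suc b) (suc c) (suc c)
    ≡⟨ cong₂ ℚ._+_ initial-terms (vandermondeTerm-last a b (suc c)) ⟩
      (∑[ j ≤ c ] vandermondeTerm a b c j ℚ.+ qᶜ⁺¹ ℚ.* ∑[ j ≤ c ] vandermondeTerm a b (suc c) j)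
        ℚ.+ qᶜ⁺¹ ℚ.* vandermondeTerm a b (suc c) (suc c)
    ≡⟨ ℚP.+-assoc (∑[ j ≤ c ] vandermondeTerm a b c j) _ _ ⟩
      ∑[ j ≤ c ] vandermondeTerm a b c j
        ℚ.+ (qᶜ⁺¹ ℚ.* ∑[ j ≤ c ] vandermondeTerm a b (suc c) j ℚ.+ qᶜ⁺¹ ℚ.* vandermondeTerm a b (suc c) (suc c))
    ≡⟨ cong (∑[ j ≤ c ] vandermondeTerm a b c j ℚ.+_) (sym (ℚP.*-distribˡ-+ qᶜ⁺¹ _ _)) ⟩
      ∑[ j ≤ c ] vandermondeTerm a b c j ℚ.+ qᶜ⁺¹ ℚ.* ∑[ j ≤ suc c ] vandermondeTerm a b (suc c) j
    ≡⟨ cong₂ (λ s t → s ℚ.+ qᶜ⁺¹ ℚ.* t) (q-vandermonde a b c) (q-vandermonde a b (suc c)) ⟩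
      gauss q (suc (a + b)) (suc c)
    ≡⟨ cong (λ n → gauss q n (suc c)) (sym (ℕP.+-suc a b)) ⟩
      gauss q (a + suc b) (suc c)
    ∎
    where
      open ≡-Reasoning
      qᶜ⁺¹ = pow q (suc c)
      initial-terms : ∑[ j ≤ c ] vandermondeTerm a (suc b) (suc c) j
                    ≡ ∑[ j ≤ c ] vandermondeTerm a b c j ℚ.+ qᶜ⁺¹ ℚ.* ∑[ j ≤ c ] vandermondeTerm a b (suc c) j
      initial-terms = begin
          ∑[ j ≤ c ] vandermondeTerm a (suc b) (suc c) j
        ≡⟨ ∑-cong c (vandermondeTerm-pascal a b c) ⟩
          ∑[ j ≤ c ] (vandermondeTerm a b c j ℚ.+ qᶜ⁺¹ ℚ.* vandermondeTerm a b (suc c) j)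
        ≡⟨ ∑-distrib-+ (vandermondeTerm a b c) (λ j → qᶜ⁺¹ ℚ.* vandermondeTerm a b (suc c) j) c ⟩
          ∑[ j ≤ c ] vandermondeTerm a b c j ℚ.+ ∑[ j ≤ c ] (qᶜ⁺¹ ℚ.* vandermondeTerm a b (suc c) j)
        ≡⟨ cong (∑[ j ≤ c ] vandermondeTerm a b c j ℚ.+_) (∑-distribˡ-* qᶜ⁺¹ (vandermondeTerm a b (suc c)) c) ⟩
          ∑[ j ≤ c ] vandermondeTerm a b c j ℚ.+ qᶜ⁺¹ ℚ.* ∑[ j ≤ c ] vandermondeTerm a b (suc c) j
        ∎

  gauss-pascal′ : ∀ n k → gauss q (suc n) (suc k) ≡ gauss q n (suc k) ℚ.+ pow q (n ∸ k) ℚ.* gauss q n k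
  gauss-pascal′ n k = begin
      gauss q (suc n) (suc k)
    ≡⟨ sym (q-vandermonde 1 n (suc k)) ⟩
      ∑[ j ≤ 1 + k ] vandermondeTerm 1 n (suc k) j
    ≡⟨ ∑-extend 1 k vanish ⟩
      1ℚ ℚ.* gauss q n (suc k) ℚ.* 1ℚ ℚ.+ gauss q 1 1 ℚ.* gauss q n k ℚ.* pow q (1 * (n + 1 ∸ suc k))
    ≡⟨ cong₂ (λ s t → 1ℚ ℚ.* gauss q n (suc k) ℚ.* 1ℚ ℚ.+ s ℚ.* gauss q n k ℚ.* pow q t) (gauss[n,n]≡1 q 1)
         (trans (ℕP.*-identityˡ _) (cong (_∸ suc k) (ℕP.+-comm n 1))) ⟩
      1ℚ ℚ.* gauss q n (suc k) ℚ.* 1ℚ ℚ.+ 1ℚ ℚ.* gauss q n k ℚ.* pow q (n ∸ k)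
    ≡⟨ solve 3 (λ x y z → con 1ℚ :* x :* con 1ℚ :+ con 1ℚ :* y :* z := x :+ z :* y)
         refl (gauss q n (suc k)) (gauss q n k) (pow q (n ∸ k)) ⟩
      gauss q n (suc k) ℚ.+ pow q (n ∸ k) ℚ.* gauss q n k
    ∎
    where
      open ≡-Reasoning
      vanish : ∀ j → 1 < j → vandermondeTerm 1 n (suc k) j ≡ 0ℚ
      vanish j 1<j rewrite n<k⇒gauss≡0 q 1<j =
        solve 2 (λ x y → con 0ℚ :* x :* y := con 0ℚ) refl (gauss q n (suc k ∸ j)) (pow q (j * (n + j ∸ suc k)))

  gauss-sym : ∀ a b → gauss q (a + b) a ≡ gauss q (a + b) b
  gauss-sym zero    b    = sym (gauss[n,n]≡1 q b)
  gauss-sym (suc a) zero = trans (cong (λ n → gauss q n (suc a)) (ℕP.+-identityʳ (suc a))) (gauss[n,n]≡1 q (suc a))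
  gauss-sym (suc a) (suc b) = begin
      gauss q (a + suc b) a ℚ.+ pow q (suc a) ℚ.* gauss q (a + suc b) (suc a)
    ≡⟨ cong₂ (λ s t → s ℚ.+ pow q (suc a) ℚ.* t) (gauss-sym a (suc b)) gauss-sym[1+a,b] ⟩
      gauss q (a + suc b) (suc b) ℚ.+ pow q (suc a) ℚ.* gauss q (a + suc b) b
    ≡⟨ cong (λ t → gauss q (a + suc b) (suc b) ℚ.+ pow q t ℚ.* gauss q (a + suc b) b) (sym [a+1+b]∸b≡1+a) ⟩
      gauss q (a + suc b) (suc b) ℚ.+ pow q (a + suc b ∸ b) ℚ.* gauss q (a + suc b) b
    ≡⟨ sym (gauss-pascal′ (a + suc b) b) ⟩
      gauss q (suc (a + suc b)) (suc b)
    ∎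
    where
      open ≡-Reasoning
      1+a+b≡a+1+b : suc a + b ≡ a + suc b
      1+a+b≡a+1+b = sym (ℕP.+-suc a b)
      gauss-sym[1+a,b] : gauss q (a + suc b) (suc a) ≡ gauss q (a + suc b) b
      gauss-sym[1+a,b] = subst (λ n → gauss q n (suc a) ≡ gauss q n b) 1+a+b≡a+1+b (gauss-sym (suc a) b)
      [a+1+b]∸b≡1+a : a + suc b ∸ b ≡ suc a
      [a+1+b]∸b≡1+a = trans (cong (_∸ b) (sym 1+a+b≡a+1+b)) (ℕP.m+n∸n≡m (suc a) b)

  gauss-complement : ∀ {m n} → 1 ≤ m → m ≤ n → gauss q (n ∸ 1) (n ∸ m) ≡ gauss q (n ∸ 1) (m ∸ 1)
  gauss-complement {suc m} 1≤m m≤n with ℕP.m≤n⇒∃[o]m+o≡n m≤n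
  ... | d , refl rewrite ℕP.m+n∸m≡n m d = sym (gauss-sym m d)

-- Enumeration of partitions

IsPartition≤ : ℕ → ℕ → List ℕ → Set
IsPartition≤ m r μ = Linked _≥_ (m ∷ μ) × All (1 ≤_) μ × sum μ ≡ r

-- The fuel bounds the number of parts and only serves termination.
mutual
  partitions : (fuel r m : ℕ) → List (List ℕ)
  partitions fuel       zero    m = [] ∷ []
  partitions zero       (suc r) m = []
  partitions (suc fuel) (suc r) m = partitionsWithHead≤ fuel (suc r) (m ⊓ suc r)

  partitionsWithHead≤ : (fuel r k : ℕ) → List (List ℕ)
  partitionsWithHead≤ fuel r zero    = []
  partitionsWithHead≤ fuel r (suc k) =
    map (suc k ∷_) (partitions fuel (r ∸ suc k) (suc k)) ++ partitionsWithHead≤ fuel r k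

partitions[1+r,0]≡[] : ∀ fuel r → partitions fuel (suc r) 0 ≡ []
partitions[1+r,0]≡[] zero       r = refl
partitions[1+r,0]≡[] (suc fuel) r = refl

∈-partitionsWithHead≤⁻ : ∀ fuel r K {μ} → μ ∈ partitionsWithHead≤ fuel r K →
  ∃₂ λ k ν → μ ≡ k ∷ ν × 1 ≤ k × k ≤ K × ν ∈ partitions fuel (r ∸ k) k
∈-partitionsWithHead≤⁻ fuel r (suc K) μ∈ with ∈-++⁻ (map (suc K ∷_) (partitions fuel (r ∸ suc K) (suc K))) μ∈
... | inj₁ μ∈head with ∈-map⁻ (suc K ∷_) μ∈head
...   | ν , ν∈ , μ≡ = suc K , ν , μ≡ , s≤s z≤n , ℕP.≤-refl , ν∈
∈-partitionsWithHead≤⁻ fuel r (suc K) μ∈ | inj₂ μ∈tail with ∈-partitionsWithHead≤⁻ fuel r K μ∈tail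
... | k , ν , μ≡ , 1≤k , k≤K , ν∈ = k , ν , μ≡ , 1≤k , ℕP.m≤n⇒m≤1+n k≤K , ν∈

∈-partitions⁻ : ∀ fuel r m {μ} → μ ∈ partitions fuel r m → IsPartition≤ m r μ
∈-partitions⁻ fuel zero m (here refl) = [-] , [] , refl
∈-partitions⁻ (suc fuel) (suc r) m μ∈ with ∈-partitionsWithHead≤⁻ fuel (suc r) (m ⊓ suc r) μ∈
... | k , ν , refl , 1≤k , k≤m⊓r , ν∈ with ∈-partitions⁻ fuel (suc r ∸ k) k ν∈
... | ordered , positive , sumν =
  ℕP.≤-trans k≤m⊓r (ℕP.m⊓n≤m m (suc r)) ∷ ordered , 1≤k ∷ positive ,
  trans (cong (k +_) sumν) (ℕP.m+[n∸m]≡n (ℕP.≤-trans k≤m⊓r (ℕP.m⊓n≤n m (suc r))))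

∈-partitionsWithHead≤⁺ : ∀ fuel r K {k ν} → 1 ≤ k → k ≤ K → ν ∈ partitions fuel (r ∸ k) k →
  k ∷ ν ∈ partitionsWithHead≤ fuel r K
∈-partitionsWithHead≤⁺ fuel r zero (s≤s _) ()
∈-partitionsWithHead≤⁺ fuel r (suc K) 1≤k k≤1+K ν∈ with ℕP.m≤n⇒m<n∨m≡n k≤1+K
... | inj₂ refl = ∈-++⁺ˡ (∈-map⁺ (suc K ∷_) ν∈)
... | inj₁ k<1+K = ∈-++⁺ʳ (map (suc K ∷_) (partitions fuel (r ∸ suc K) (suc K)))
                          (∈-partitionsWithHead≤⁺ fuel r K 1≤k (ℕP.≤-pred k<1+K) ν∈)

∈-partitions⁺ : ∀ fuel r m {μ} → IsPartition≤ m r μ → length μ ≤ fuel → μ ∈ partitions fuel r m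
∈-partitions⁺ fuel _ m {[]} (_ , _ , refl) _ = here refl
∈-partitions⁺ (suc fuel) _ m {suc k ∷ ν} (k<m ∷ ordered , 1≤k ∷ positive , refl) (s≤s |ν|≤fuel) =
  ∈-partitionsWithHead≤⁺ fuel (suc k + sum ν) (m ⊓ (suc k + sum ν)) 1≤k (ℕP.⊓-glb k<m (s≤s (ℕP.m≤m+n k (sum ν))))
    (subst (λ r → ν ∈ partitions fuel r (suc k)) (sym (ℕP.m+n∸m≡n k (sum ν)))
           (∈-partitions⁺ fuel (sum ν) (suc k) (ordered , positive , refl) |ν|≤fuel))

mutual
  partitions-unique : ∀ fuel r m → Unique (partitions fuel r m)
  partitions-unique fuel       zero    m = [] ∷ []
  partitions-unique zero       (suc r) m = []
  partitions-unique (suc fuel) (suc r) m = partitionsWithHead≤-unique fuel (suc r) (m ⊓ suc r)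

  partitionsWithHead≤-unique : ∀ fuel r K → Unique (partitionsWithHead≤ fuel r K)
  partitionsWithHead≤-unique fuel r zero    = []
  partitionsWithHead≤-unique fuel r (suc K) =
    Unique.++⁺ (Unique.map⁺ ListP.∷-injectiveʳ (partitions-unique fuel (r ∸ suc K) (suc K)))
               (partitionsWithHead≤-unique fuel r K) disjoint
    where
      disjoint : ∀ {μ} → ¬ (μ ∈ map (suc K ∷_) (partitions fuel (r ∸ suc K) (suc K)) × μ ∈ partitionsWithHead≤ fuel r K)
      disjoint (μ∈head , μ∈tail) with ∈-map⁻ (suc K ∷_) μ∈head | ∈-partitionsWithHead≤⁻ fuel r K μ∈tail
      ... | _ , _ , refl | k , _ , μ≡ , _ , k≤K , _ =
        ℕP.<-irrefl refl (ℕP.≤-trans (ℕP.≤-reflexive (ListP.∷-injectiveˡ μ≡)) k≤K)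

length≤sum : ∀ {μ} → All (1 ≤_) μ → length μ ≤ sum μ
length≤sum []                          = z≤n
length≤sum {suc k ∷ μ} (_ ∷ positive) = s≤s (ℕP.≤-trans (length≤sum positive) (ℕP.m≤n+m (sum μ) k))

partitionsWithLargest : ℕ → ℕ → List (List ℕ)
partitionsWithLargest n m = map (m ∷_) (partitions n (n ∸ m) m)

partitionsWithLargest-unique : ∀ n m → Unique (partitionsWithLargest n m)
partitionsWithLargest-unique n m = Unique.map⁺ ListP.∷-injectiveʳ (partitions-unique n (n ∸ m) m)

∈-partitionsWithLargest⇔ : ∀ {n m} → 1 ≤ m → m ≤ n →
  ∀ λs → λs ∈ partitionsWithLargest n m ⇔ IsPartitionWithLargest n m λs
∈-partitionsWithLargest⇔ {n} {m} 1≤m m≤n λs = mk⇔ to from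
  where
    to : λs ∈ partitionsWithLargest n m → IsPartitionWithLargest n m λs
    to λs∈ with ∈-map⁻ (m ∷_) λs∈
    ... | μ , μ∈ , refl with ∈-partitions⁻ n (n ∸ m) m μ∈
    ... | ordered , positive , sumμ =
      ordered , 1≤m ∷ positive , trans (cong (m +_) sumμ) (ℕP.m+[n∸m]≡n m≤n) , μ , refl
    from : IsPartitionWithLargest n m λs → λs ∈ partitionsWithLargest n m
    from (ordered , _ ∷ positive , sumλs , μ , refl) =
      ∈-map⁺ (m ∷_) (∈-partitions⁺ n (n ∸ m) m (ordered , positive , sumμ)
        (ℕP.≤-trans (length≤sum positive) (ℕP.≤-trans (ℕP.m≤n+m (sum μ) m) (ℕP.≤-reflexive sumλs))))
      where
        sumμ : sum μ ≡ n ∸ m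
        sumμ = trans (sym (ℕP.m+n∸m≡n m (sum μ))) (cong (_∸ m) sumλs)

sumℚ-↭ : ∀ {xs ys} → xs ↭ ys → sumℚ xs ≡ sumℚ ys
sumℚ-↭ p = foldr-commMonoid ℚ-+-0.setoid ℚ-+-0.isCommutativeMonoid (↭⇒↭ₛ p)
  where module ℚ-+-0 = CommutativeMonoid ℚP.+-0-commutativeMonoid

sumℚ-map-set : ∀ {A : Set} (w : A → ℚ) {xs ys} → Unique xs → Unique ys → xs ∼[ set ] ys →
  sumℚ (map w xs) ≡ sumℚ (map w ys)
sumℚ-map-set w xs! ys! xs∼ys = sumℚ-↭ (↭.map⁺ w (∼bag⇒↭ (unique∧set⇒bag xs! ys! xs∼ys)))

sumℚ-++ : ∀ xs ys → sumℚ (xs ++ ys) ≡ sumℚ xs ℚ.+ sumℚ ys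
sumℚ-++ []       ys = sym (ℚP.+-identityˡ _)
sumℚ-++ (x ∷ xs) ys = trans (cong (x ℚ.+_) (sumℚ-++ xs ys)) (sym (ℚP.+-assoc x _ _))

sumℚ-map-∘-* : ∀ {A B : Set} {w : B → ℚ} {f : A → B} {w′ : A → ℚ} c → (∀ x → w (f x) ≡ c ℚ.* w′ x) →
  ∀ xs → sumℚ (map w (map f xs)) ≡ c ℚ.* sumℚ (map w′ xs)
sumℚ-map-∘-* c wf≡cw′ []       = sym (ℚP.*-zeroʳ c)
sumℚ-map-∘-* c wf≡cw′ (x ∷ xs) =
  trans (cong₂ ℚ._+_ (wf≡cw′ x) (sumℚ-map-∘-* c wf≡cw′ xs)) (sym (ℚP.*-distribˡ-+ c _ _))

-- Partitions with parts at most m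

module _ (q : ℚ) where

  weightUnder : ℕ → List ℕ → ℚ
  weightUnder m μ = pow q (sumSq μ) ℚ.* prodQbin q (m ∷ μ)

  weight-∷ : ∀ m μ → weight q (m ∷ μ) ≡ pow q (m * m) ℚ.* weightUnder m μ
  weight-∷ m μ rewrite pow-distribˡ-+-* q (m * m) (sumSq μ) = ℚP.*-assoc (pow q (m * m)) _ _

  weightUnder-∷ : ∀ m k ν → weightUnder m (k ∷ ν) ≡ qbin q m k ℚ.* pow q (k * k) ℚ.* weightUnder k ν
  weightUnder-∷ m k ν rewrite pow-distribˡ-+-* q (k * k) (sumSq ν) =
    solve 4 (λ a b c d → (a :* b) :* (c :* d) := c :* a :* (b :* d)) refl
      (pow q (k * k)) (pow q (sumSq ν)) (qbin q m k) (prodQbin q (k ∷ ν))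

  partitionSum : (fuel r m : ℕ) → ℚ
  partitionSum fuel r m = sumℚ (map (weightUnder m) (partitions fuel r m))

  firstPartTerm : ℕ → ℕ → ℕ → ℕ → ℚ
  firstPartTerm fuel r m k = qbin q m k ℚ.* pow q (k * k) ℚ.* partitionSum fuel (r ∸ k) k

  partitionsWithHead≤-sum : ∀ fuel r m K →
    sumℚ (map (weightUnder m) (partitionsWithHead≤ fuel (suc r) K)) ≡ ∑[ k ≤ K ] firstPartTerm fuel (suc r) m k
  partitionsWithHead≤-sum fuel r m zero rewrite partitions[1+r,0]≡[] fuel r = refl
  partitionsWithHead≤-sum fuel r m (suc K) = begin
      sumℚ (map (weightUnder m) (map (suc K ∷_) ps ++ partitionsWithHead≤ fuel (suc r) K))
    ≡⟨ cong sumℚ (ListP.map-++ (weightUnder m) (map (suc K ∷_) ps) _) ⟩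
      sumℚ (map (weightUnder m) (map (suc K ∷_) ps) ++ map (weightUnder m) (partitionsWithHead≤ fuel (suc r) K))
    ≡⟨ sumℚ-++ (map (weightUnder m) (map (suc K ∷_) ps)) _ ⟩
      sumℚ (map (weightUnder m) (map (suc K ∷_) ps)) ℚ.+ sumℚ (map (weightUnder m) (partitionsWithHead≤ fuel (suc r) K))
    ≡⟨ cong₂ ℚ._+_ (sumℚ-map-∘-* (qbin q m (suc K) ℚ.* pow q (suc K * suc K)) (weightUnder-∷ m (suc K)) ps) (partitionsWithHead≤-sum fuel r m K) ⟩
      firstPartTerm fuel (suc r) m (suc K) ℚ.+ ∑[ k ≤ K ] firstPartTerm fuel (suc r) m k
    ≡⟨ ℚP.+-comm (firstPartTerm fuel (suc r) m (suc K)) _ ⟩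
      ∑[ k ≤ suc K ] firstPartTerm fuel (suc r) m k
    ∎
    where
      open ≡-Reasoning
      ps = partitions fuel (suc r ∸ suc K) (suc K)

  module _ (q≢1 : q ≢ 1ℚ) (q≢-1 : q ≢ - 1ℚ) where

    partitionSum-closedForm : ∀ fuel r m → r ≤ fuel → 1 ≤ m →
      partitionSum fuel r m ≡ pow q r ℚ.* gauss q (m + r ∸ 1) r
    partitionSum-closedForm fuel       zero    m _            _   = refl
    partitionSum-closedForm (suc fuel) (suc r) m (s≤s r≤fuel) 1≤m = begin
        partitionSum (suc fuel) (suc r) m
      ≡⟨ partitionsWithHead≤-sum fuel r m (m ⊓ suc r) ⟩
        ∑[ k ≤ m ⊓ suc r ] firstPartTerm fuel (suc r) m k
      ≡⟨ ∑-cong (m ⊓ suc r) (λ k k≤m⊓r → firstPartTerm≡ k (ℕP.≤-trans k≤m⊓r (ℕP.m⊓n≤n m (suc r)))) ⟩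
        ∑[ k ≤ m ⊓ suc r ] (pow q (suc r) ℚ.* vandermondeTerm q m r (suc r) k)
      ≡⟨ ∑-⊓ m (suc r) vanish ⟩
        ∑[ k ≤ suc r ] (pow q (suc r) ℚ.* vandermondeTerm q m r (suc r) k)
      ≡⟨ ∑-distribˡ-* (pow q (suc r)) (vandermondeTerm q m r (suc r)) (suc r) ⟩
        pow q (suc r) ℚ.* ∑[ k ≤ suc r ] vandermondeTerm q m r (suc r) k
      ≡⟨ cong (pow q (suc r) ℚ.*_) (q-vandermonde q m r (suc r)) ⟩
        pow q (suc r) ℚ.* gauss q (m + r) (suc r)
      ≡⟨ cong (λ a → pow q (suc r) ℚ.* gauss q a (suc r)) (sym (cong (_∸ 1) (ℕP.+-suc m r))) ⟩
        pow q (suc r) ℚ.* gauss q (m + suc r ∸ 1) (suc r)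
      ∎
      where
        open ≡-Reasoning
        vanish : ∀ k → m < k → pow q (suc r) ℚ.* vandermondeTerm q m r (suc r) k ≡ 0ℚ
        vanish k m<k rewrite n<k⇒gauss≡0 q m<k =
          solve 3 (λ x y z → x :* (con 0ℚ :* y :* z) := con 0ℚ) refl
            (pow q (suc r)) (gauss q r (suc r ∸ k)) (pow q (k * (r + k ∸ suc r)))
        firstPartTerm≡ : ∀ k → k ≤ suc r → firstPartTerm fuel (suc r) m k ≡ pow q (suc r) ℚ.* vandermondeTerm q m r (suc r) k
        firstPartTerm≡ zero _ rewrite partitions[1+r,0]≡[] fuel r | n<k⇒gauss≡0 q (ℕP.n<1+n r) =
          solve 1 (λ x → con 1ℚ :* con 1ℚ :* con 0ℚ := x :* (con 1ℚ :* con 0ℚ :* con 1ℚ)) refl (pow q (suc r))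
        firstPartTerm≡ (suc k) (s≤s k≤r) = begin
            qbin q m (suc k) ℚ.* pow q (suc k * suc k) ℚ.* partitionSum fuel (r ∸ k) (suc k)
          ≡⟨ cong₂ (λ a b → a ℚ.* pow q (suc k * suc k) ℚ.* b) (qbin≡gauss q q≢1 q≢-1 m (suc k))
               (partitionSum-closedForm fuel (r ∸ k) (suc k) (ℕP.≤-trans (ℕP.m∸n≤m r k) r≤fuel) (s≤s z≤n)) ⟩
            G ℚ.* pow q (suc k * suc k) ℚ.* (pow q (r ∸ k) ℚ.* gauss q (k + (r ∸ k)) (r ∸ k))
          ≡⟨ cong (λ a → G ℚ.* pow q (suc k * suc k) ℚ.* (pow q (r ∸ k) ℚ.* gauss q a (r ∸ k))) (ℕP.m+[n∸m]≡n k≤r) ⟩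
            G ℚ.* pow q (suc k * suc k) ℚ.* (pow q (r ∸ k) ℚ.* X)
          ≡⟨ solve 4 (λ g a b x → g :* a :* (b :* x) := g :* x :* (a :* b)) refl G (pow q (suc k * suc k)) (pow q (r ∸ k)) X ⟩
            G ℚ.* X ℚ.* (pow q (suc k * suc k) ℚ.* pow q (r ∸ k))
          ≡⟨ cong (G ℚ.* X ℚ.*_) (sym (pow-distribˡ-+-* q (suc k * suc k) (r ∸ k))) ⟩
            G ℚ.* X ℚ.* pow q (suc k * suc k + (r ∸ k))
          ≡⟨ cong (λ e → G ℚ.* X ℚ.* pow q e) (closedForm-exponent k≤r) ⟩
            G ℚ.* X ℚ.* pow q (suc r + E)
          ≡⟨ cong (G ℚ.* X ℚ.*_) (pow-distribˡ-+-* q (suc r) E) ⟩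
            G ℚ.* X ℚ.* (pow q (suc r) ℚ.* pow q E)
          ≡⟨ solve 4 (λ g x a b → g :* x :* (a :* b) := a :* (g :* x :* b)) refl G X (pow q (suc r)) (pow q E) ⟩
            pow q (suc r) ℚ.* vandermondeTerm q m r (suc r) (suc k)
          ∎
          where
            G = gauss q m (suc k)
            X = gauss q r (r ∸ k)
            E = suc k * (r + suc k ∸ suc r)

mainTheorem7 : (m n : ℕ) → 1 ≤ m → m ≤ n →
    (q : ℚ) → q ≢ 1ℚ → q ≢ - 1ℚ →
    (L : List (List ℕ)) → Unique L →
    (∀ λs → (λs ∈ L) ⇔ IsPartitionWithLargest n m λs) →
    sumℚ (map (weight q) L) ≡ pow q (m * m + n ∸ m) ℚ.* qbin q (n ∸ 1) (m ∸ 1)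
mainTheorem7 m n 1≤m m≤n q q≢1 q≢-1 L L! L⇔ = begin
    sumℚ (map (weight q) L)
  ≡⟨ sumℚ-map-set (weight q) L! (partitionsWithLargest-unique n m)
       (λ {λs} → ⇔.trans (L⇔ λs) (⇔.sym (∈-partitionsWithLargest⇔ 1≤m m≤n λs))) ⟩
    sumℚ (map (weight q) (partitionsWithLargest n m))
  ≡⟨ sumℚ-map-∘-* (pow q (m * m)) (weight-∷ q m) (partitions n (n ∸ m) m) ⟩
    pow q (m * m) ℚ.* partitionSum q n (n ∸ m) m
  ≡⟨ cong (pow q (m * m) ℚ.*_) (partitionSum-closedForm q q≢1 q≢-1 n (n ∸ m) m (ℕP.m∸n≤m n m) 1≤m) ⟩
    pow q (m * m) ℚ.* (pow q (n ∸ m) ℚ.* gauss q (m + (n ∸ m) ∸ 1) (n ∸ m))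
  ≡⟨ cong (λ a → pow q (m * m) ℚ.* (pow q (n ∸ m) ℚ.* gauss q (a ∸ 1) (n ∸ m))) (ℕP.m+[n∸m]≡n m≤n) ⟩
    pow q (m * m) ℚ.* (pow q (n ∸ m) ℚ.* gauss q (n ∸ 1) (n ∸ m))
  ≡⟨ sym (ℚP.*-assoc (pow q (m * m)) _ _) ⟩
    pow q (m * m) ℚ.* pow q (n ∸ m) ℚ.* gauss q (n ∸ 1) (n ∸ m)
  ≡⟨ cong₂ ℚ._*_ (sym (pow-distribˡ-+-* q (m * m) (n ∸ m))) (gauss-complement q 1≤m m≤n) ⟩
    pow q (m * m + (n ∸ m)) ℚ.* gauss q (n ∸ 1) (m ∸ 1)
  ≡⟨ cong₂ (λ e b → pow q e ℚ.* b) (sym (ℕP.+-∸-assoc (m * m) m≤n)) (sym (qbin≡gauss q q≢1 q≢-1 (n ∸ 1) (m ∸ 1))) ⟩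
    pow q (m * m + n ∸ m) ℚ.* qbin q (n ∸ 1) (m ∸ 1)
  ∎
  where
    open ≡-Reasoning
    module ⇔ = IsEquivalence ⇔-isEquivalence
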